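{- Let $B$ be a finite set in an arbitrary commutative group, and let $k$ be a positive integer. Assume that $B$ is $k$-covering. Then for every positive integer $m$, \[ |(m+1)B|\leq |B|\,J(k,m). \]
   Context: $mX$ denotes the $m$-fold iterated sumset $X+\dots+X$. A set $B$ in a group is $k$-covering if there is a set $T$ with $|T|=k$ and $B+B\subseteq B+(T-T)$. $J(k,m)$ is the number of $k$-tuples of integers $(x_1,\dots,x_k)$ satisfying $\sum_{i=1}^k x_i^+=\sum_{i=1}^k x_i^-\leq m$, where $x^+=\max(x,0)$ and $x^-=\max(-x,0)$. -}

module Defs where

open import Level using (Level; _⊔_)
open import Algebra.Bundles using (AbelianGroup)
open import Data.Nat using (ℕ; zero; suc; _+_; _*_; _≤_; _≤?_)
open import Data.Nat.Properties using () renaming (_≟_ to _≟ℕ_)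
open import Data.Integer using (ℤ; +_; -[1+_]) renaming (_-_ to _-ℤ_)
open import Data.List using (List; []; _∷_; length; map; concatMap; filter; upTo)
open import Data.List.Relation.Unary.Any using (Any)
open import Data.List.Relation.Unary.AllPairs using (AllPairs)
open import Data.Vec using (Vec; []; _∷_)
open import Data.Vec.Relation.Unary.All using (All)
import Data.List.Relation.Unary.All
open import Data.Product using (Σ; ∃; _×_; _,_)
open import Relation.Nullary using (¬_)
open import Relation.Nullary.Decidable using (_×-dec_)
open import Relation.Binary.PropositionalEquality using (_≡_)

pos : ℤ → ℕ
pos (+ n)     = n
pos -[1+ n ]  = 0

neg : ℤ → ℕ
neg (+ n)     = 0
neg -[1+ n ]  = suc n

sumPos : ∀ {k} → Vec ℤ k → ℕ
sumPos []       = 0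
sumPos (x ∷ xs) = pos x + sumPos xs

sumNeg : ∀ {k} → Vec ℤ k → ℕ
sumNeg []       = 0
sumNeg (x ∷ xs) = neg x + sumNeg xs

JCond : ℕ → ∀ {k} → Vec ℤ k → Set
JCond m v = (sumPos v ≡ sumNeg v) × (sumPos v ≤ m)

range : ℕ → List ℤ
range m = map (λ i → (+ i) -ℤ (+ m)) (upTo (suc (m + m)))

tuples : (k : ℕ) → List ℤ → List (Vec ℤ k)
tuples zero    xs = [] ∷ []
tuples (suc k) xs = concatMap (λ x → map (x ∷_) (tuples k xs)) xs

-- J(k,m): number of k-tuples of integers with Σ x⁺ = Σ x⁻ ≤ m.
-- Any such tuple has every |x_i| ≤ m, so it suffices to enumerate [-m,m]^k.
J : ℕ → ℕ → ℕ
J k m = length (filter (λ v → (sumPos v ≟ℕ sumNeg v) ×-dec (sumPos v ≤? m))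
                       (tuples k (range m)))

module _ {c ℓ : Level} (G : AbelianGroup c ℓ) where
  open AbelianGroup G renaming (Carrier to A)

  _∈ₛ_ : A → List A → Set (c ⊔ ℓ)
  x ∈ₛ X = Any (x ≈_) X

  -- a list with pairwise distinct elements represents a finite set of size = length
  Distinct : List A → Set (c ⊔ ℓ)
  Distinct = AllPairs (λ x y → ¬ (x ≈ y))

  sumV : ∀ {n} → Vec A n → A
  sumV []       = ε
  sumV (x ∷ xs) = x ∙ sumV xs

  InSumset : ℕ → List A → A → Set (c ⊔ ℓ)
  InSumset n X x = Σ (Vec A n) λ v → All (_∈ₛ X) v × (x ≈ sumV v)

  Covering : ℕ → List A → Set (c ⊔ ℓ)
  Covering k B = Σ (List A) λ T → Distinct T × (length T ≡ k) ×
    (∀ b₁ b₂ → b₁ ∈ₛ B → b₂ ∈ₛ B →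
       ∃ λ b → ∃ λ t₁ → ∃ λ t₂ → b ∈ₛ B × t₁ ∈ₛ T × t₂ ∈ₛ T ×
         ((b₁ ∙ b₂) ≈ (b ∙ (t₁ ∙ (t₂ ⁻¹)))))

  CardLe : (A → Set (c ⊔ ℓ)) → ℕ → Set (c ⊔ ℓ)
  CardLe P N = ∀ (xs : List A) → Distinct xs → Data.List.Relation.Unary.All.All P xs → length xs ≤ N

{-# OPTIONS --safe #-}
-- Write T = {t₁, …, t_k}. Adding the summands of x ∈ (m+1)B one at a time, and each time absorbing
-- the sum of the new summand and the current base point into B + (T − T), gives
-- x + Σ qᵢ tᵢ = b + Σ pᵢ tᵢ with b ∈ B and p, q ∈ ℕᵏ both of total m. The integer vector z = p − q
-- then satisfies Σ zᵢ⁺ = Σ zᵢ⁻ ≤ m, so x = b + Σ zᵢ tᵢ is one of the at most |B| J(k,m) elements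
-- obtained from a choice of b ∈ B and of a tuple counted by J(k,m).
module Submission where

open import Defs
open import Level using (Level)
open import Algebra.Bundles using (AbelianGroup)
open import Data.Nat using (ℕ; suc; _*_; _≤_; _<_)
open import Data.List using (List; length)

open import Level using (_⊔_)
open import Data.Nat using (zero; _+_; _∸_; _≤?_; z≤n; s≤s)
open import Data.Nat.Properties
  using (module ≤-Reasoning; ≤-refl; m≤n⇒m≤1+n; +-identityʳ; +-suc; +-mono-≤; +-cancelʳ-≡;
         m∸n≤m; m∸n+n≡m; m+n≤o⇒m≤o; m+n≤o⇒n≤o; +-commutativeSemigroup)
  renaming (_≟_ to _≟ℕ_)
open import Data.Integer using (ℤ; +_; -[1+_]; _⊖_) renaming (_-_ to _-ℤ_)
open import Data.Integer.Properties using ([1+m]⊖[1+n]≡m⊖n; ⊖-≥; [+m]-[+n]≡m⊖n; +-cancelˡ-⊖)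
open import Data.List using ([]; _∷_; _++_; map; filter; cartesianProductWith)
open import Data.List.Properties using (length-++; length-map; length-removeAt′)
open import Data.List.Relation.Unary.All as Allₗ using ([]; _∷_)
open import Data.List.Relation.Unary.Any as Any using (here; there; index)
open import Data.Vec using (Vec; []; _∷_; sum; zipWith; replicate) renaming (map to mapᵥ)
open import Data.Vec.Relation.Unary.All using (All; []; _∷_)
open import Data.Product using (∃; _,_)
open import Relation.Nullary using (¬_; contradiction)
open import Relation.Nullary.Decidable using (_×-dec_)
open import Relation.Binary.Bundles using (Setoid)
import Relation.Binary.PropositionalEquality as ≡
open ≡ using (_≡_; refl; cong; cong₂; subst; module ≡-Reasoning)
open import Algebra.Properties.CommutativeSemigroup +-commutativeSemigroup
  using () renaming (interchange to +-interchange)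

pos-⊖-≤ : ∀ a b → pos (a ⊖ b) ≤ a
pos-⊖-≤ a       zero    rewrite ⊖-≥ (z≤n {a}) = ≤-refl
pos-⊖-≤ zero    (suc b) = z≤n
pos-⊖-≤ (suc a) (suc b) rewrite [1+m]⊖[1+n]≡m⊖n a b = m≤n⇒m≤1+n (pos-⊖-≤ a b)

⊖-balance : ∀ a b → pos (a ⊖ b) + b ≡ neg (a ⊖ b) + a
⊖-balance a       zero    rewrite ⊖-≥ (z≤n {a}) = +-identityʳ a
⊖-balance zero    (suc b) = ≡.sym (+-identityʳ (suc b))
⊖-balance (suc a) (suc b) rewrite [1+m]⊖[1+n]≡m⊖n a b =
  ≡.trans (+-suc (pos (a ⊖ b)) b) (≡.trans (cong suc (⊖-balance a b)) (≡.sym (+-suc (neg (a ⊖ b)) a)))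

pos-neg-⊖ : ∀ x → pos x ⊖ neg x ≡ x
pos-neg-⊖ (+ n)    = ⊖-≥ z≤n
pos-neg-⊖ -[1+ n ] = refl

sumPos-⊖-≤ : ∀ {k} (p q : Vec ℕ k) → sumPos (zipWith _⊖_ p q) ≤ sum p
sumPos-⊖-≤ []      []      = z≤n
sumPos-⊖-≤ (a ∷ p) (b ∷ q) = +-mono-≤ (pos-⊖-≤ a b) (sumPos-⊖-≤ p q)

sumPos-⊖-balance : ∀ {k} (p q : Vec ℕ k) →
  sumPos (zipWith _⊖_ p q) + sum q ≡ sumNeg (zipWith _⊖_ p q) + sum p
sumPos-⊖-balance []      []      = refl
sumPos-⊖-balance (a ∷ p) (b ∷ q) = begin
  (pos (a ⊖ b) + sumPos d) + (b + sum q)  ≡⟨ +-interchange (pos (a ⊖ b)) (sumPos d) b (sum q) ⟩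
  (pos (a ⊖ b) + b) + (sumPos d + sum q)  ≡⟨ cong₂ _+_ (⊖-balance a b) (sumPos-⊖-balance p q) ⟩
  (neg (a ⊖ b) + a) + (sumNeg d + sum p)  ≡⟨ +-interchange (neg (a ⊖ b)) a (sumNeg d) (sum p) ⟩
  (neg (a ⊖ b) + sumNeg d) + (a + sum p)  ∎
  where
  open ≡-Reasoning
  d = zipWith _⊖_ p q

JCond-⊖ : ∀ {k m} (p q : Vec ℕ k) → sum p ≡ m → sum q ≡ m → JCond m (zipWith _⊖_ p q)
JCond-⊖ p q refl q≡p =
  +-cancelʳ-≡ (sum p) _ _ (≡.trans (cong (_+_ (sumPos d)) (≡.sym q≡p)) (sumPos-⊖-balance p q)) ,
  sumPos-⊖-≤ p q
  where d = zipWith _⊖_ p q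

module _ where
  open import Data.List.Membership.Propositional using (_∈_)
  open import Data.List.Membership.Propositional.Properties using (∈-map⁺; ∈-concatMap⁺; ∈-filter⁺; ∈-upTo⁺)

  Jtuples : (k m : ℕ) → List (Vec ℤ k)
  Jtuples k m = filter (λ v → (sumPos v ≟ℕ sumNeg v) ×-dec (sumPos v ≤? m)) (tuples k (range m))

  ⊖-∈-range : ∀ {m a b} → a ≤ m → b ≤ m → a ⊖ b ∈ range m
  ⊖-∈-range {m} {a} {b} a≤m b≤m =
    subst (_∈ range m) shift (∈-map⁺ (λ j → + j -ℤ + m) (∈-upTo⁺ (s≤s (+-mono-≤ (m∸n≤m m b) a≤m))))
    where
    open ≡-Reasoning
    shift : + ((m ∸ b) + a) -ℤ + m ≡ a ⊖ b
    shift = begin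
      + ((m ∸ b) + a) -ℤ + m       ≡⟨ [+m]-[+n]≡m⊖n ((m ∸ b) + a) m ⟩
      (m ∸ b) + a ⊖ m              ≡⟨ cong ((m ∸ b) + a ⊖_) (≡.sym (m∸n+n≡m b≤m)) ⟩
      (m ∸ b) + a ⊖ ((m ∸ b) + b)  ≡⟨ +-cancelˡ-⊖ (m ∸ b) a b ⟩
      a ⊖ b                        ∎

  ∈-range : ∀ {m} x → pos x ≤ m → neg x ≤ m → x ∈ range m
  ∈-range {m} x pos≤m neg≤m = subst (_∈ range m) (pos-neg-⊖ x) (⊖-∈-range pos≤m neg≤m)

  entries-∈-range : ∀ {k m} (v : Vec ℤ k) → sumPos v ≤ m → sumNeg v ≤ m → All (_∈ range m) v
  entries-∈-range []      _     _     = []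
  entries-∈-range (x ∷ v) pos≤m neg≤m =
    ∈-range x (m+n≤o⇒m≤o (pos x) pos≤m) (m+n≤o⇒m≤o (neg x) neg≤m) ∷
    entries-∈-range v (m+n≤o⇒n≤o (pos x) pos≤m) (m+n≤o⇒n≤o (neg x) neg≤m)

  ∈-tuples : ∀ {k xs} (v : Vec ℤ k) → All (_∈ xs) v → v ∈ tuples k xs
  ∈-tuples []      []               = here refl
  ∈-tuples (x ∷ v) (x∈xs ∷ v⊆xs) =
    ∈-concatMap⁺ _ (Any.map (λ { refl → ∈-map⁺ (x ∷_) (∈-tuples v v⊆xs) }) x∈xs)

  ∈-Jtuples : ∀ {k m} {v : Vec ℤ k} → JCond m v → v ∈ Jtuples k m
  ∈-Jtuples {v = v} cond@(balanced , pos≤m) =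
    ∈-filter⁺ _ (∈-tuples v (entries-∈-range v pos≤m (subst (_≤ _) balanced pos≤m))) cond

length-cartesianProductWith : ∀ {a b c} {A : Set a} {B : Set b} {C : Set c} (f : A → B → C) xs ys →
  length (cartesianProductWith f xs ys) ≡ length xs * length ys
length-cartesianProductWith f []       ys = refl
length-cartesianProductWith f (x ∷ xs) ys = begin
  length (map (f x) ys ++ cartesianProductWith f xs ys)          ≡⟨ length-++ (map (f x) ys) ⟩
  length (map (f x) ys) + length (cartesianProductWith f xs ys)  ≡⟨ cong₂ _+_ (length-map (f x) ys)
                                                                      (length-cartesianProductWith f xs ys) ⟩
  length ys + length xs * length ys                              ∎
  where open ≡-Reasoning

module _ {a ℓ} (S : Setoid a ℓ) where
  open Setoid S
  open import Data.List.Membership.Setoid S using (_∈_; _─_)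
  open import Data.List.Relation.Unary.Unique.Setoid S using (Unique)
  open import Data.List.Relation.Unary.AllPairs using ([]; _∷_)

  ∈-─ : ∀ {x y xs} (x∈xs : x ∈ xs) → y ∈ xs → ¬ x ≈ y → y ∈ xs ─ x∈xs
  ∈-─ (here x≈z)   (here y≈z)   x≉y = contradiction (trans x≈z (sym y≈z)) x≉y
  ∈-─ (here _)     (there y∈xs) _   = y∈xs
  ∈-─ (there _)    (here y≈z)   _   = here y≈z
  ∈-─ (there x∈xs) (there y∈xs) x≉y = there (∈-─ x∈xs y∈xs x≉y)

  Unique⇒length≤ : ∀ {xs ys} → Unique xs → Allₗ.All (_∈ ys) xs → length xs ≤ length ys
  Unique⇒length≤ []                     []                = z≤n
  Unique⇒length≤ {x ∷ xs} {ys} (x≉xs ∷ xs!) (x∈ys ∷ xs⊆ys) =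
    subst (suc (length xs) ≤_) (≡.sym (length-removeAt′ ys (index x∈ys)))
      (s≤s (Unique⇒length≤ xs! (Allₗ.zipWith (λ (y∈ys , x≉y) → ∈-─ x∈ys y∈ys x≉y) (xs⊆ys , x≉xs))))

module _ {c ℓ} (G : AbelianGroup c ℓ) where
  open AbelianGroup G renaming (Carrier to A)
  open import Data.List.Membership.Setoid setoid using (_∈_)
  open import Data.Product using (_×_)

  CoveredBy : List A → List A → Set (c ⊔ ℓ)
  CoveredBy B T = ∀ b₁ b₂ → b₁ ∈ B → b₂ ∈ B →
    ∃ λ b → ∃ λ t₁ → ∃ λ t₂ → b ∈ B × t₁ ∈ T × t₂ ∈ T × ((b₁ ∙ b₂) ≈ (b ∙ (t₁ ∙ (t₂ ⁻¹))))

module Representations {c ℓ} (G : AbelianGroup c ℓ) where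
  open AbelianGroup G renaming (Carrier to A; refl to ≈-refl)
  open import Algebra.Properties.AbelianGroup G using (x≈z//y; ∙-cancelʳ; //-rightDividesˡ)
  open import Algebra.Properties.CommutativeSemigroup commutativeSemigroup
    using (interchange; x∙yz≈y∙xz; xy∙z≈xz∙y; xy∙z≈x∙zy)
  open import Algebra.Properties.Monoid.Mult monoid using (_×_; ×-homo-+; ×-congˡ)
  open import Data.List.Membership.Setoid setoid using (_∈_)
  open import Data.List.Membership.Setoid.Properties using (∈-resp-≈; ∈-cartesianProductWith⁺)
  open import Relation.Binary.Reasoning.Setoid setoid

  lincomb : (T : List A) → Vec ℕ (length T) → A
  lincomb []      []       = ε
  lincomb (t ∷ T) (n ∷ ns) = n × t ∙ lincomb T ns

  lincombℤ : (T : List A) → Vec ℤ (length T) → A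
  lincombℤ T z = lincomb T (mapᵥ pos z) - lincomb T (mapᵥ neg z)

  increment : (T : List A) {t : A} → t ∈ T → Vec ℕ (length T) → Vec ℕ (length T)
  increment (_ ∷ _) (here _)    (n ∷ ns) = suc n ∷ ns
  increment (_ ∷ T) (there t∈T) (n ∷ ns) = n ∷ increment T t∈T ns

  sum-increment : ∀ T {t} (t∈T : t ∈ T) ns → sum (increment T t∈T ns) ≡ suc (sum ns)
  sum-increment (_ ∷ _) (here _)    (n ∷ ns) = ≡.refl
  sum-increment (_ ∷ T) (there t∈T) (n ∷ ns) =
    ≡.trans (cong (_+_ n) (sum-increment T t∈T ns)) (+-suc n (sum ns))

  lincomb-increment : ∀ T {t} (t∈T : t ∈ T) ns → lincomb T (increment T t∈T ns) ≈ t ∙ lincomb T ns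
  lincomb-increment (u ∷ T) (here t≈u)  (n ∷ ns) =
    trans (assoc u (n × u) (lincomb T ns)) (∙-congʳ (sym t≈u))
  lincomb-increment (u ∷ T) (there t∈T) (n ∷ ns) =
    trans (∙-congˡ (lincomb-increment T t∈T ns)) (x∙yz≈y∙xz (n × u) _ (lincomb T ns))

  lincomb-⊖-balance : ∀ T (p q : Vec ℕ (length T)) →
    lincomb T (mapᵥ pos (zipWith _⊖_ p q)) ∙ lincomb T q ≈ lincomb T (mapᵥ neg (zipWith _⊖_ p q)) ∙ lincomb T p
  lincomb-⊖-balance []      []      []      = ≈-refl
  lincomb-⊖-balance (t ∷ T) (a ∷ p) (b ∷ q) = begin
    (pos (a ⊖ b) × t ∙ P⁺) ∙ (b × t ∙ Q)  ≈⟨ interchange _ P⁺ _ Q ⟩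
    (pos (a ⊖ b) × t ∙ b × t) ∙ (P⁺ ∙ Q)  ≈⟨ ∙-cong multiples (lincomb-⊖-balance T p q) ⟩
    (neg (a ⊖ b) × t ∙ a × t) ∙ (P⁻ ∙ P)  ≈⟨ interchange _ _ P⁻ P ⟩
    (neg (a ⊖ b) × t ∙ P⁻) ∙ (a × t ∙ P)  ∎
    where
    P⁺ = lincomb T (mapᵥ pos (zipWith _⊖_ p q))
    P⁻ = lincomb T (mapᵥ neg (zipWith _⊖_ p q))
    P  = lincomb T p
    Q  = lincomb T q
    multiples : pos (a ⊖ b) × t ∙ b × t ≈ neg (a ⊖ b) × t ∙ a × t
    multiples = begin
      pos (a ⊖ b) × t ∙ b × t  ≈⟨ ×-homo-+ t (pos (a ⊖ b)) b ⟨
      (pos (a ⊖ b) + b) × t    ≈⟨ ×-congˡ (⊖-balance a b) ⟩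
      (neg (a ⊖ b) + a) × t    ≈⟨ ×-homo-+ t (neg (a ⊖ b)) a ⟩
      neg (a ⊖ b) × t ∙ a × t  ∎

  x≈y∙[u-v]⇒x∙v≈y∙u : ∀ {x y u v} → x ≈ y ∙ (u - v) → x ∙ v ≈ y ∙ u
  x≈y∙[u-v]⇒x∙v≈y∙u {x} {y} {u} {v} x≈y∙[u-v] = begin
    x ∙ v                ≈⟨ ∙-congʳ x≈y∙[u-v] ⟩
    y ∙ (u - v) ∙ v      ≈⟨ assoc y (u - v) v ⟩
    y ∙ ((u - v) ∙ v)    ≈⟨ ∙-congˡ (//-rightDividesˡ v u) ⟩
    y ∙ u                ∎

  x∙q≈b∙p⇒u∙q≈w∙p⇒x≈b∙[u-w] : ∀ {x q b p u w} → x ∙ q ≈ b ∙ p → u ∙ q ≈ w ∙ p → x ≈ b ∙ (u - w)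
  x∙q≈b∙p⇒u∙q≈w∙p⇒x≈b∙[u-w] {x} {q} {b} {p} {u} {w} x∙q≈b∙p u∙q≈w∙p = begin
    x              ≈⟨ x≈z//y x w (b ∙ u) (∙-cancelʳ q (x ∙ w) (b ∙ u) x∙w∙q≈b∙u∙q) ⟩
    b ∙ u ∙ w ⁻¹   ≈⟨ assoc b u (w ⁻¹) ⟩
    b ∙ (u - w)    ∎
    where
    x∙w∙q≈b∙u∙q : x ∙ w ∙ q ≈ b ∙ u ∙ q
    x∙w∙q≈b∙u∙q = begin
      x ∙ w ∙ q    ≈⟨ xy∙z≈xz∙y x w q ⟩
      x ∙ q ∙ w    ≈⟨ ∙-congʳ x∙q≈b∙p ⟩
      b ∙ p ∙ w    ≈⟨ xy∙z≈x∙zy b p w ⟩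
      b ∙ (w ∙ p)  ≈⟨ ∙-congˡ u∙q≈w∙p ⟨
      b ∙ (u ∙ q)  ≈⟨ assoc b u q ⟨
      b ∙ u ∙ q    ∎

  module _ (B T : List A) where

    record Representation (n : ℕ) (x : A) : Set (c ⊔ ℓ) where
      field
        base      : A
        base∈B    : base ∈ B
        plus      : Vec ℕ (length T)
        minus     : Vec ℕ (length T)
        sum-plus  : sum plus ≡ n
        sum-minus : sum minus ≡ n
        balanced  : x ∙ lincomb T minus ≈ base ∙ lincomb T plus

    representation-base : ∀ {a} → a ∈ B → Representation zero (a ∙ ε)
    representation-base {a} a∈B = record
      { base = a ; base∈B = a∈B
      ; plus = zeros ; minus = zeros ; sum-plus = sum-zeros (length T) ; sum-minus = sum-zeros (length T)
      ; balanced = ∙-congʳ (identityʳ a)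
      }
      where
      zeros = replicate (length T) 0
      sum-zeros : ∀ k → sum (replicate k 0) ≡ 0
      sum-zeros zero    = ≡.refl
      sum-zeros (suc k) = sum-zeros k

    module _ (covered : CoveredBy G B T) where

      representation-step : ∀ {n a x} → a ∈ B → Representation n x → Representation (suc n) (a ∙ x)
      representation-step {a = a} {x = x} a∈B rx
        with covered a (Representation.base rx) a∈B (Representation.base∈B rx)
      ... | b , t₁ , t₂ , b∈B , t₁∈T , t₂∈T , a∙base≈b∙[t₁-t₂] = record
        { base = b ; base∈B = b∈B
        ; plus = increment T t₁∈T plus ; minus = increment T t₂∈T minus
        ; sum-plus = ≡.trans (sum-increment T t₁∈T plus) (cong suc sum-plus)
        ; sum-minus = ≡.trans (sum-increment T t₂∈T minus) (cong suc sum-minus)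
        ; balanced = begin
            a ∙ x ∙ lincomb T (increment T t₂∈T minus)  ≈⟨ ∙-congˡ (lincomb-increment T t₂∈T minus) ⟩
            a ∙ x ∙ (t₂ ∙ lincomb T minus)              ≈⟨ interchange a x t₂ (lincomb T minus) ⟩
            a ∙ t₂ ∙ (x ∙ lincomb T minus)              ≈⟨ ∙-congˡ balanced ⟩
            a ∙ t₂ ∙ (base ∙ lincomb T plus)            ≈⟨ interchange a t₂ base (lincomb T plus) ⟩
            a ∙ base ∙ (t₂ ∙ lincomb T plus)            ≈⟨ assoc (a ∙ base) t₂ (lincomb T plus) ⟨
            a ∙ base ∙ t₂ ∙ lincomb T plus              ≈⟨ ∙-congʳ (x≈y∙[u-v]⇒x∙v≈y∙u a∙base≈b∙[t₁-t₂]) ⟩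
            b ∙ t₁ ∙ lincomb T plus                     ≈⟨ assoc b t₁ (lincomb T plus) ⟩
            b ∙ (t₁ ∙ lincomb T plus)                   ≈⟨ ∙-congˡ (lincomb-increment T t₁∈T plus) ⟨
            b ∙ lincomb T (increment T t₁∈T plus)       ∎
        }
        where open Representation rx

      sumset-representation : ∀ n (v : Vec A (suc n)) → All (_∈ B) v → Representation n (sumV G v)
      sumset-representation zero    (a ∷ []) (a∈B ∷ [])  = representation-base a∈B
      sumset-representation (suc n) (a ∷ v)  (a∈B ∷ v⊆B) =
        representation-step a∈B (sumset-representation n v v⊆B)

      candidates : ℕ → List A
      candidates m = cartesianProductWith (λ b z → b ∙ lincombℤ T z) B (Jtuples (length T) m)

      sumset⊆candidates : ∀ {m x} → InSumset G (suc m) B x → x ∈ candidates m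
      sumset⊆candidates {m} {x} (v , v⊆B , x≈Σv) =
        ∈-resp-≈ setoid (sym x≈b∙z)
          (∈-cartesianProductWith⁺ setoid (≡.setoid _) setoid (λ { b≈b′ ≡.refl → ∙-congʳ b≈b′ })
             base∈B (∈-Jtuples (JCond-⊖ plus minus sum-plus sum-minus)))
        where
        open Representation (sumset-representation m v v⊆B)
        x≈b∙z : x ≈ base ∙ lincombℤ T (zipWith _⊖_ plus minus)
        x≈b∙z = x∙q≈b∙p⇒u∙q≈w∙p⇒x≈b∙[u-w]
          (trans (∙-congʳ x≈Σv) balanced) (lincomb-⊖-balance T plus minus)

mainTheorem7 : ∀ {c ℓ : Level} (G : AbelianGroup c ℓ) (B : List (AbelianGroup.Carrier G))
    → Distinct G B → (k : ℕ) → 0 < k → Covering G k B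
    → (m : ℕ) → 0 < m
    → CardLe G (InSumset G (suc m) B) (length B * J k m)
mainTheorem7 G B _ .(length T) _ (T , _ , ≡.refl , covered) m _ xs xs-distinct xs⊆[m+1]B = begin
  length xs                          ≤⟨ Unique⇒length≤ setoid xs-distinct
                                          (Allₗ.map (sumset⊆candidates B T covered) xs⊆[m+1]B) ⟩
  length (candidates B T covered m)  ≡⟨ length-cartesianProductWith _ B (Jtuples (length T) m) ⟩
  length B * J (length T) m          ∎
  where
  open AbelianGroup G using (setoid)
  open Representations G using (candidates; sumset⊆candidates)
  open ≤-Reasoning
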